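{- Let $\mathcal{A}$ be an HDA satisfying conditions HM1 and HM2 with respect to a $\ltimes$-transition system $\mathcal{T}$. Let $x\in(P_\mathcal{A})_m$ with $m\ge2$, let $1\le i<j\le m$, and let $d^{k_1}_1\cdots d^{k_{i-1}}_{i-1}d^{k_{i+1}}_{i+1}\cdots d^{k_m}_mx$ and $d^{l_1}_1\cdots d^{l_{j-1}}_{j-1}d^{l_{j+1}}_{j+1}\cdots d^{l_m}_mx$ be edges of $x$ (all $k_r,l_r\in\{0,1\}$). Then $\lambda_\mathcal{A}(d^{k_1}_1\cdots d^{k_{i-1}}_{i-1}d^{k_{i+1}}_{i+1}\cdots d^{k_m}_mx)\ltimes_\mathcal{T}\lambda_\mathcal{A}(d^{l_1}_1\cdots d^{l_{j-1}}_{j-1}d^{l_{j+1}}_{j+1}\cdots d^{l_m}_mx)$.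
   Context: A precubical set $P$ is a family of sets $(P_n)_{n\ge0}$ with face maps $d^k_i:P_n\to P_{n-1}$ ($n>0$, $k\in\{0,1\}$, $1\le i\le n$) satisfying $d^k_id^l_j=d^l_{j-1}d^k_i$ for $i<j$; composites of face maps are applied right to left. An HDA is $\mathcal{A}=(P_\mathcal{A},I_\mathcal{A},F_\mathcal{A},\Sigma_\mathcal{A},\lambda_\mathcal{A})$ with $P_\mathcal{A}$ a precubical set, $I_\mathcal{A}$ a vertex, $F_\mathcal{A}$ a set of vertices, $\lambda_\mathcal{A}:(P_\mathcal{A})_1\to\Sigma_\mathcal{A}$ with $\lambda_\mathcal{A}(d^0_iy)=\lambda_\mathcal{A}(d^1_iy)$ for 2-cubes $y$, $i=1,2$; $\mathcal{A}_{\le1}$ keeps only cubes of degree $\le1$. A transition system is an HDA without cubes of degree $\ge2$ in which two edges with equal label, equal $d^0_1$ and equal $d^1_1$ coincide. A $\ltimes$-transition system $\mathcal{T}$ is a transition system $U(\mathcal{T})$ with an arbitrary binary relation $\ltimes_\mathcal{T}$ on its label set. Conditions: (HM1) $\mathcal{A}_{\le1}=U(\mathcal{T})$; (HM2) for all $y\in(P_\mathcal{A})_2$, $\lambda_\mathcal{A}(d^0_2y)\ltimes_\mathcal{T}\lambda_\mathcal{A}(d^0_1y)$. -}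

module Defs where

open import Data.Nat as ℕ using (ℕ; zero; suc)
open import Data.Bool using (Bool; false; true)
open import Data.Fin as Fin using (Fin; toℕ; fromℕ; inject₁; lower₁)
open import Data.Empty using (⊥)
open import Relation.Nullary using (¬_; yes; no)
open import Relation.Binary.PropositionalEquality using (_≡_; subst; cong)
open import Function using (_∘_)

-- Conventions: face maps d^k_i : P_{n+1} → P_n are written  d k i
-- with k : Bool (false = 0, true = 1) and i : Fin (suc n) the
-- 0-based index (i.e. paper index i+1).

record HDA : Set₁ where
  field
    P    : ℕ → Set
    d    : ∀ {n} → Bool → Fin (suc n) → P (suc n) → P n
    -- precubical identity  d^k_i d^l_j = d^l_{j-1} d^k_i  for i < j.
    -- i (as index on P_{n+1}) and i' (same number, on P_{n+2}),
    -- j (on P_{n+2}) and j' = j - 1 (on P_{n+1}).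
    cubical : ∀ {n} (k l : Bool) (i : Fin (suc n)) (i' : Fin (suc (suc n)))
                (j : Fin (suc (suc n))) (j' : Fin (suc n)) →
                toℕ i ≡ toℕ i' → toℕ i ℕ.< toℕ j → toℕ j ≡ suc (toℕ j') →
                (x : P (suc (suc n))) →
                d k i (d l j x) ≡ d l j' (d k i' x)
    I    : P 0
    F    : P 0 → Set
    Σ    : Set
    λ'   : P 1 → Σ
    labelLaw : (y : P 2) (i : Fin 2) → λ' (d false i y) ≡ λ' (d true i y)

open HDA

module _ (A : HDA) where
  truncP : ℕ → Set
  truncP 0 = P A 0
  truncP 1 = P A 1
  truncP (suc (suc n)) = ⊥

  truncD : ∀ {n} → Bool → Fin (suc n) → truncP (suc n) → truncP n
  truncD {zero} k i x = d A k i x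
  truncD {suc n} k i ()

  truncCubical : ∀ {n} (k l : Bool) (i : Fin (suc n)) (i' : Fin (suc (suc n)))
                (j : Fin (suc (suc n))) (j' : Fin (suc n)) →
                toℕ i ≡ toℕ i' → toℕ i ℕ.< toℕ j → toℕ j ≡ suc (toℕ j') →
                (x : truncP (suc (suc n))) →
                truncD k i (truncD l j x) ≡ truncD l j' (truncD k i' x)
  truncCubical k l i i' j j' _ _ _ ()

  truncLabel : (y : truncP 2) (i : Fin 2) →
               λ' A (truncD false i y) ≡ λ' A (truncD true i y)
  truncLabel ()

_≤1 : HDA → HDA
A ≤1 = record
  { P = truncP A ; d = truncD A ; cubical = truncCubical A
  ; I = I A ; F = F A ; Σ = Σ A ; λ' = λ' A ; labelLaw = truncLabel A }

record IsTransitionSystem (A : HDA) : Set where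
  field
    noHigher : ∀ n → ¬ P A (suc (suc n))
    determ   : (e e' : P A 1) → λ' A e ≡ λ' A e' →
               d A false Fin.zero e ≡ d A false Fin.zero e' →
               d A true Fin.zero e ≡ d A true Fin.zero e' → e ≡ e'

record ⋉TS : Set₁ where
  field
    U    : HDA
    isTS : IsTransitionSystem U
    _⋉_  : Σ U → Σ U → Set

open ⋉TS

HM1 : HDA → ⋉TS → Set₁
HM1 A T = (A ≤1) ≡ U T

toT : (A : HDA) (T : ⋉TS) → HM1 A T → Σ A → Σ (U T)
toT A T h = subst (λ B → Σ B) h

HM2 : (A : HDA) (T : ⋉TS) → HM1 A T → Set
HM2 A T h = (y : P A 2) →
  _⋉_ T (toT A T h (λ' A (d A false (Fin.suc Fin.zero) y)))
        (toT A T h (λ' A (d A false Fin.zero y)))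

-- d^{k_1}_1 ⋯ d^{k_n}_n applied to an element of P_{n+1}
-- (all coordinates but the last are collapsed), yielding an edge.
lowerFaces : (A : HDA) (n : ℕ) → (Fin n → Bool) → P A (suc n) → P A 1
lowerFaces A zero k x = x
lowerFaces A (suc n) k x =
  lowerFaces A n (k ∘ inject₁) (d A (k (fromℕ n)) (inject₁ (fromℕ n)) x)

-- edgeAt A n i k x  =  d^{k_1}_1 ⋯ d^{k_{i-1}}_{i-1} d^{k_{i+1}}_{i+1} ⋯ d^{k_m}_m x
-- for x ∈ P_m, m = n+1, i the 0-based skipped coordinate; k i is ignored.
edgeAt : (A : HDA) (n : ℕ) → Fin (suc n) → (Fin (suc n) → Bool) → P A (suc n) → P A 1
edgeAt A zero i k x = x
edgeAt A (suc n) i k x with suc n ℕ.≟ toℕ i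
... | yes _ = lowerFaces A (suc n) (k ∘ inject₁) x
... | no ne = edgeAt A n (lower₁ i ne) (k ∘ inject₁)
                (d A (k (fromℕ (suc n))) (fromℕ (suc n)) x)

module Submission where

-- Taking first a face d^b_t in a direction t other than i does not change the edge in
-- direction i (cubical identities), it only renumbers coordinates. Consequently the label
-- of an edge depends only on its direction: for 2-cubes this is the labelling law, and in
-- higher dimensions two vertex choices can be linked through faces in two directions
-- s, t ≠ i. So for i < j we may take both edges at the vertex 0⋯0 and cut x down along
-- faces in directions other than i and j until a 2-cube is left, where HM2 applies.

open import Defs
open import Data.Nat as ℕ using (ℕ; zero; suc; s≤s)
open import Data.Nat.Properties using (≰⇒>; <⇒≱)
open import Data.Bool using (Bool; true; false)
open import Data.Fin as Fin using (Fin; zero; suc; toℕ; fromℕ; inject₁; punchIn; punchOut)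
open import Data.Fin.Properties
  using (toℕ-fromℕ; toℕ-inject₁; toℕ-inject₁-≢; lower₁-inject₁′; ≤fromℕ;
         punchIn-punchOut; punchOut-cancel-≤)
open import Data.Fin.Relation.Unary.Top using (view; ‵fromℕ; ‵inject₁)
open import Data.Vec.Functional using (removeAt; updateAt)
open import Data.Vec.Functional.Properties using (updateAt-updates; updateAt-minimal)
open import Data.Product using (∃-syntax; _×_; _,_)
open import Relation.Nullary using (yes; no; contradiction)
open import Relation.Binary.PropositionalEquality
open import Function using (_∘_; const)

private variable n : ℕ

punchIn-fromℕ : (r : Fin n) → punchIn (fromℕ n) r ≡ inject₁ r
punchIn-fromℕ zero    = refl
punchIn-fromℕ (suc r) = cong suc (punchIn-fromℕ r)

punchIn-inject₁-fromℕ : (t : Fin (suc n)) → punchIn (inject₁ t) (fromℕ n) ≡ fromℕ (suc n)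
punchIn-inject₁-fromℕ {zero}  zero    = refl
punchIn-inject₁-fromℕ {suc n} zero    = refl
punchIn-inject₁-fromℕ {suc n} (suc t) = cong suc (punchIn-inject₁-fromℕ t)

punchIn-inject₁ : (t : Fin (suc n)) (r : Fin n) →
                  punchIn (inject₁ t) (inject₁ r) ≡ inject₁ (punchIn t r)
punchIn-inject₁ zero    r       = refl
punchIn-inject₁ (suc t) zero    = refl
punchIn-inject₁ (suc t) (suc r) = cong suc (punchIn-inject₁ t r)

punchOut-mono-< : {t i j : Fin (suc n)} (t≢i : t ≢ i) (t≢j : t ≢ j) →
                  i Fin.< j → punchOut t≢i Fin.< punchOut t≢j
punchOut-mono-< t≢i t≢j i<j = ≰⇒> (<⇒≱ i<j ∘ punchOut-cancel-≤ t≢j t≢i)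

avoid₂ : (i j : Fin (suc (suc (suc n)))) → ∃[ t ] t ≢ i × t ≢ j
avoid₂ zero          zero          = suc zero , (λ ()) , (λ ())
avoid₂ zero          (suc zero)    = suc (suc zero) , (λ ()) , (λ ())
avoid₂ zero          (suc (suc j)) = suc zero , (λ ()) , (λ ())
avoid₂ (suc zero)    zero          = suc (suc zero) , (λ ()) , (λ ())
avoid₂ (suc (suc i)) zero          = suc zero , (λ ()) , (λ ())
avoid₂ (suc i)       (suc j)       = zero , (λ ()) , (λ ())

module Edges (A : HDA) where
  open HDA A

  face-comm : ∀ b c (i j : Fin (suc n)) → i Fin.≤ j → (x : P (suc (suc n))) →
              d b i (d c (suc j) x) ≡ d c j (d b (inject₁ i) x)
  face-comm b c i j i≤j = cubical b c i (inject₁ i) (suc j) j (sym (toℕ-inject₁ i)) (s≤s i≤j) refl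

  lowerFaces-cong : ∀ n {k k' : Fin n → Bool} → k ≗ k' → (x : P (suc n)) →
                    lowerFaces A n k x ≡ lowerFaces A n k' x
  lowerFaces-cong zero    k≗k' x = refl
  lowerFaces-cong (suc n) k≗k' x rewrite k≗k' (fromℕ n) =
    lowerFaces-cong n (k≗k' ∘ inject₁) _

  edgeAt-cong : ∀ n (i : Fin (suc n)) {k k' : Fin (suc n) → Bool} → k ≗ k' →
                (x : P (suc n)) → edgeAt A n i k x ≡ edgeAt A n i k' x
  edgeAt-cong zero    i k≗k' x = refl
  edgeAt-cong (suc n) i k≗k' x with suc n ℕ.≟ toℕ i
  ... | yes _ = lowerFaces-cong (suc n) (k≗k' ∘ inject₁) x
  ... | no _ rewrite k≗k' (fromℕ (suc n)) = edgeAt-cong n _ (k≗k' ∘ inject₁) _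

  edgeAt-fromℕ : ∀ n (k : Fin (suc n) → Bool) (x : P (suc n)) →
                 edgeAt A n (fromℕ n) k x ≡ lowerFaces A n (k ∘ inject₁) x
  edgeAt-fromℕ zero    k x = refl
  edgeAt-fromℕ (suc n) k x with suc n ℕ.≟ toℕ (fromℕ (suc n))
  ... | yes _ = refl
  ... | no ≢top = contradiction (sym (toℕ-fromℕ (suc n))) ≢top

  edgeAt-inject₁ : ∀ n (i : Fin (suc n)) (k : Fin (suc (suc n)) → Bool) (x : P (suc (suc n))) →
                   edgeAt A (suc n) (inject₁ i) k x
                   ≡ edgeAt A n i (k ∘ inject₁) (d (k (fromℕ (suc n))) (fromℕ (suc n)) x)
  edgeAt-inject₁ n i k x with suc n ℕ.≟ toℕ (inject₁ i)
  ... | yes ≡top = contradiction ≡top (toℕ-inject₁-≢ i)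
  ... | no ≢top = cong (λ j → edgeAt A n j _ _) (lower₁-inject₁′ i ≢top)

  lowerFaces-face : ∀ n (t : Fin (suc n)) (k : Fin (suc n) → Bool) (x : P (suc (suc n))) →
                    lowerFaces A (suc n) k x
                    ≡ lowerFaces A n (removeAt k t) (d (k t) (inject₁ t) x)
  lowerFaces-face n t k x with view t
  lowerFaces-face n .(fromℕ n) k x | ‵fromℕ =
    lowerFaces-cong n (cong k ∘ sym ∘ punchIn-fromℕ) _
  lowerFaces-face (suc m) .(inject₁ t) k x | ‵inject₁ t = begin
    lowerFaces A (suc m) (k ∘ inject₁) (d c (inject₁ top) x)
      ≡⟨ lowerFaces-face m t (k ∘ inject₁) _ ⟩
    lowerFaces A m (k ∘ inject₁ ∘ punchIn t) (d b (inject₁ t) (d c (inject₁ top) x))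
      ≡⟨ cong (lowerFaces A m _) (face-comm b c (inject₁ t) (inject₁ (fromℕ m)) t≤top x) ⟩
    lowerFaces A m (k ∘ inject₁ ∘ punchIn t) (d c (inject₁ (fromℕ m)) (d b (inject₁ (inject₁ t)) x))
      ≡⟨ lowerFaces-cong m (cong k ∘ sym ∘ punchIn-inject₁ t) _ ⟩
    lowerFaces A m (removeAt k (inject₁ t) ∘ inject₁) (d c (inject₁ (fromℕ m)) (d b (inject₁ (inject₁ t)) x))
      ≡⟨ cong (λ e → lowerFaces A m (removeAt k (inject₁ t) ∘ inject₁) (d e _ (d b (inject₁ (inject₁ t)) x)))
              (cong k (sym (punchIn-inject₁-fromℕ t))) ⟩
    lowerFaces A (suc m) (removeAt k (inject₁ t)) (d b (inject₁ (inject₁ t)) x) ∎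
    where
    open ≡-Reasoning
    top = fromℕ (suc m)
    b = k (inject₁ t)
    c = k top
    t≤top : inject₁ t Fin.≤ inject₁ (fromℕ m)
    t≤top = subst₂ ℕ._≤_ (sym (toℕ-inject₁ t)) (sym (toℕ-inject₁ (fromℕ m))) (≤fromℕ t)

  edgeAt-face : ∀ n (t : Fin (suc (suc n))) (i : Fin (suc n)) (k : Fin (suc (suc n)) → Bool)
                (x : P (suc (suc n))) →
                edgeAt A (suc n) (punchIn t i) k x ≡ edgeAt A n i (removeAt k t) (d (k t) t x)
  edgeAt-face n t i k x with view t
  edgeAt-face n .(fromℕ (suc n)) i k x | ‵fromℕ = begin
    edgeAt A (suc n) (punchIn top i) k x
      ≡⟨ cong (λ j → edgeAt A (suc n) j k x) (punchIn-fromℕ i) ⟩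
    edgeAt A (suc n) (inject₁ i) k x
      ≡⟨ edgeAt-inject₁ n i k x ⟩
    edgeAt A n i (k ∘ inject₁) (d (k top) top x)
      ≡⟨ edgeAt-cong n i (cong k ∘ sym ∘ punchIn-fromℕ) _ ⟩
    edgeAt A n i (removeAt k top) (d (k top) top x) ∎
    where
    open ≡-Reasoning
    top = fromℕ (suc n)
  edgeAt-face n .(inject₁ t) i k x | ‵inject₁ t with view i
  edgeAt-face n .(inject₁ t) .(fromℕ n) k x | ‵inject₁ t | ‵fromℕ = begin
    edgeAt A (suc n) (punchIn (inject₁ t) (fromℕ n)) k x
      ≡⟨ cong (λ j → edgeAt A (suc n) j k x) (punchIn-inject₁-fromℕ t) ⟩
    edgeAt A (suc n) (fromℕ (suc n)) k x
      ≡⟨ edgeAt-fromℕ (suc n) k x ⟩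
    lowerFaces A (suc n) (k ∘ inject₁) x
      ≡⟨ lowerFaces-face n t (k ∘ inject₁) x ⟩
    lowerFaces A n (k ∘ inject₁ ∘ punchIn t) y
      ≡⟨ lowerFaces-cong n (cong k ∘ sym ∘ punchIn-inject₁ t) y ⟩
    lowerFaces A n (removeAt k (inject₁ t) ∘ inject₁) y
      ≡⟨ sym (edgeAt-fromℕ n (removeAt k (inject₁ t)) y) ⟩
    edgeAt A n (fromℕ n) (removeAt k (inject₁ t)) y ∎
    where
    open ≡-Reasoning
    y = d (k (inject₁ t)) (inject₁ t) x
  edgeAt-face (suc m) .(inject₁ t) .(inject₁ i) k x | ‵inject₁ t | ‵inject₁ i = begin
    edgeAt A (suc (suc m)) (punchIn (inject₁ t) (inject₁ i)) k x
      ≡⟨ cong (λ j → edgeAt A (suc (suc m)) j k x) (punchIn-inject₁ t i) ⟩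
    edgeAt A (suc (suc m)) (inject₁ (punchIn t i)) k x
      ≡⟨ edgeAt-inject₁ (suc m) (punchIn t i) k x ⟩
    edgeAt A (suc m) (punchIn t i) (k ∘ inject₁) (d c top x)
      ≡⟨ edgeAt-face m t i (k ∘ inject₁) (d c top x) ⟩
    edgeAt A m i (k ∘ inject₁ ∘ punchIn t) (d b t (d c top x))
      ≡⟨ cong (edgeAt A m i _) (face-comm b c t (fromℕ (suc m)) (≤fromℕ t) x) ⟩
    edgeAt A m i (k ∘ inject₁ ∘ punchIn t) (d c (fromℕ (suc m)) y)
      ≡⟨ edgeAt-cong m i (cong k ∘ sym ∘ punchIn-inject₁ t) _ ⟩
    edgeAt A m i (removeAt k (inject₁ t) ∘ inject₁) (d c (fromℕ (suc m)) y)
      ≡⟨ cong (λ e → edgeAt A m i (removeAt k (inject₁ t) ∘ inject₁) (d e (fromℕ (suc m)) y))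
              (cong k (sym (punchIn-inject₁-fromℕ t))) ⟩
    edgeAt A m i (removeAt k (inject₁ t) ∘ inject₁)
      (d (removeAt k (inject₁ t) (fromℕ (suc m))) (fromℕ (suc m)) y)
      ≡⟨ sym (edgeAt-inject₁ m i (removeAt k (inject₁ t)) y) ⟩
    edgeAt A (suc m) (inject₁ i) (removeAt k (inject₁ t)) y ∎
    where
    open ≡-Reasoning
    top = fromℕ (suc (suc m))
    b = k (inject₁ t)
    c = k top
    y = d b (inject₁ t) x

  edgeAt-avoiding : ∀ n {t i : Fin (suc (suc n))} (t≢i : t ≢ i) (k : Fin (suc (suc n)) → Bool)
                    (x : P (suc (suc n))) →
                    edgeAt A (suc n) i k x
                    ≡ edgeAt A n (punchOut t≢i) (removeAt k t) (d (k t) t x)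
  edgeAt-avoiding n {t} t≢i k x =
    trans (cong (λ j → edgeAt A (suc n) j k x) (sym (punchIn-punchOut t≢i)))
          (edgeAt-face n t (punchOut t≢i) k x)

  opposite-edges-label : ∀ b c (y : P 2) i → λ' (d b i y) ≡ λ' (d c i y)
  opposite-edges-label false false y i = refl
  opposite-edges-label false true  y i = labelLaw y i
  opposite-edges-label true  false y i = sym (labelLaw y i)
  opposite-edges-label true  true  y i = refl

  edgeLabel-agreeing : ∀ n {t i : Fin (suc (suc n))} (t≢i : t ≢ i) →
    (∀ κ κ' y → λ' (edgeAt A n (punchOut t≢i) κ y) ≡ λ' (edgeAt A n (punchOut t≢i) κ' y)) →
    {k k' : Fin (suc (suc n)) → Bool} → k t ≡ k' t → (x : P (suc (suc n))) →
    λ' (edgeAt A (suc n) i k x) ≡ λ' (edgeAt A (suc n) i k' x)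
  edgeLabel-agreeing n {t} {i} t≢i face-irrelevant {k} {k'} kt≡k't x = begin
    λ' (edgeAt A (suc n) i k x)
      ≡⟨ cong λ' (edgeAt-avoiding n t≢i k x) ⟩
    λ' (edgeAt A n i′ (removeAt k t) (d (k t) t x))
      ≡⟨ face-irrelevant (removeAt k t) (removeAt k' t) _ ⟩
    λ' (edgeAt A n i′ (removeAt k' t) (d (k t) t x))
      ≡⟨ cong (λ b → λ' (edgeAt A n i′ (removeAt k' t) (d b t x))) kt≡k't ⟩
    λ' (edgeAt A n i′ (removeAt k' t) (d (k' t) t x))
      ≡⟨ cong λ' (sym (edgeAt-avoiding n t≢i k' x)) ⟩
    λ' (edgeAt A (suc n) i k' x) ∎
    where
    open ≡-Reasoning
    i′ = punchOut t≢i

  edgeLabel-irrelevant : ∀ n (i : Fin (suc n)) (k k' : Fin (suc n) → Bool) (x : P (suc n)) →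
                         λ' (edgeAt A n i k x) ≡ λ' (edgeAt A n i k' x)
  edgeLabel-irrelevant zero i k k' x = refl
  edgeLabel-irrelevant (suc zero) zero k k' x =
    opposite-edges-label (k (suc zero)) (k' (suc zero)) x (suc zero)
  edgeLabel-irrelevant (suc zero) (suc zero) k k' x =
    opposite-edges-label (k zero) (k' zero) x zero
  edgeLabel-irrelevant (suc (suc n)) i k k' x =
    let (t , t≢i , _) = avoid₂ i i
        (s , s≢i , s≢t) = avoid₂ i t
    in begin
    λ' (edgeAt A (suc (suc n)) i k x)
      ≡⟨ edgeLabel-agreeing (suc n) t≢i (edgeLabel-irrelevant (suc n) (punchOut t≢i))
                            (sym (updateAt-updates t k')) x ⟩
    λ' (edgeAt A (suc (suc n)) i (updateAt k' t (const (k t))) x)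
      ≡⟨ edgeLabel-agreeing (suc n) s≢i (edgeLabel-irrelevant (suc n) (punchOut s≢i))
                            (updateAt-minimal s t k' s≢t) x ⟩
    λ' (edgeAt A (suc (suc n)) i k' x) ∎
    where open ≡-Reasoning

module _ (A : HDA) (T : ⋉TS) (h1 : HM1 A T) (hm2 : HM2 A T h1) where
  open HDA A
  open Edges A

  _⋉ᴬ_ : Σ → Σ → Set
  a ⋉ᴬ b = ⋉TS._⋉_ T (toT A T h1 a) (toT A T h1 b)

  -- removeAt (const false) t is again const false, so the induction stays at the
  -- vertex 0⋯0, and for 2-cubes its two edges are literally d⁰₂ x and d⁰₁ x.
  falseEdges-⋉ : ∀ n (i j : Fin (suc (suc n))) → i Fin.< j → (x : P (suc (suc n))) →
                 λ' (edgeAt A (suc n) i (const false) x) ⋉ᴬ λ' (edgeAt A (suc n) j (const false) x)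
  falseEdges-⋉ zero zero (suc zero) _ x = hm2 x
  falseEdges-⋉ zero (suc zero) (suc zero) (s≤s ()) x
  falseEdges-⋉ (suc n) i j i<j x =
    let (t , t≢i , t≢j) = avoid₂ i j in
    subst₂ _⋉ᴬ_ (cong λ' (sym (edgeAt-avoiding (suc n) t≢i (const false) x)))
                (cong λ' (sym (edgeAt-avoiding (suc n) t≢j (const false) x)))
                (falseEdges-⋉ n _ _ (punchOut-mono-< t≢i t≢j i<j) (d false t x))

  edges-⋉ : ∀ n (i j : Fin (suc (suc n))) → i Fin.< j → (x : P (suc (suc n)))
            (k l : Fin (suc (suc n)) → Bool) →
            λ' (edgeAt A (suc n) i k x) ⋉ᴬ λ' (edgeAt A (suc n) j l x)
  edges-⋉ n i j i<j x k l =
    subst₂ _⋉ᴬ_ (edgeLabel-irrelevant (suc n) i (const false) k x)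
                (edgeLabel-irrelevant (suc n) j (const false) l x)
                (falseEdges-⋉ n i j i<j x)

proposition4p7 : (A : HDA) (T : ⋉TS) (h1 : HM1 A T) → HM2 A T h1 →
    (m : ℕ) → 2 ℕ.≤ suc m → (i j : Fin (suc m)) → i Fin.< j →
    (x : HDA.P A (suc m)) (k l : Fin (suc m) → Bool) →
    ⋉TS._⋉_ T (toT A T h1 (HDA.λ' A (edgeAt A m i k x)))
              (toT A T h1 (HDA.λ' A (edgeAt A m j l x)))
proposition4p7 A T h1 hm2 zero    (s≤s ()) i j i<j x k l
proposition4p7 A T h1 hm2 (suc n) _        i j i<j x k l = edges-⋉ A T h1 hm2 n i j i<j x k l
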